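{- Let $G$ be a multigraph and let $G'$ be its underlying simple graph. Suppose there is a minimum zero forcing set $S$ of $G'$ together with a sequence of forces, starting from $S$, that colors all vertices and in which every force $u\to w$ is performed along a pair $\{u,w\}$ joined by exactly one edge in $G$. Then $S$ is also a zero forcing set of $G$, and $Z(G')=Z(G)$.
   Context: Graphs are finite. A multigraph may have several edges between the same pair of vertices (no loops); its underlying simple graph has an edge $uw$ exactly when $u$ and $w$ are joined by at least one edge. Zero forcing on a simple graph $H$: an initial set of vertices is colored blue, the rest are white; repeatedly, if a blue vertex $u$ has exactly one white neighbor $w$, then $u$ forces $w$ to become blue. A set is a zero forcing set if this process eventually colors every vertex blue; $Z(H)$ is the minimum size of a zero forcing set. Zero forcing on a multigraph $G$ is the same, except that a blue vertex $u$ may force its unique white neighbor $w$ only if $u$ and $w$ are joined by exactly one edge (a singleton edge); $Z(G)$ is defined accordingly. -}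

module Defs where

open import Data.Nat using (ℕ; _≤_; _<_)
open import Data.Fin using (Fin)
open import Data.Fin.Subset using (Subset; _∈_; _∉_; ⁅_⁆; _∪_; ⊤; ∣_∣)
open import Data.List using (List; []; _∷_)
open import Data.List.Relation.Unary.All using (All)
open import Data.Product using (_×_; _,_; Σ; ∃)
open import Relation.Nullary using (¬_)
open import Relation.Binary.PropositionalEquality using (_≡_)

-- A finite multigraph on vertex set Fin n: mult u w = number of edges between u and w.
record Multigraph (n : ℕ) : Set where
  field
    mult   : Fin n → Fin n → ℕ
    symm   : ∀ u w → mult u w ≡ mult w u
    noLoop : ∀ u → mult u u ≡ 0

record SimpleGraph (n : ℕ) : Set₁ where
  field
    Adj    : Fin n → Fin n → Set
    symm   : ∀ {u w} → Adj u w → Adj w u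
    irrefl : ∀ u → ¬ Adj u u

underlying : ∀ {n} → Multigraph n → SimpleGraph n
underlying G = record
  { Adj = λ u w → 1 ≤ mult u w
  ; symm = λ {u} {w} p → subst' (symm u w) p
  ; irrefl = λ u p → noLoopAbsurd (noLoop u) p
  }
  where
    open Multigraph G
    open import Relation.Binary.PropositionalEquality using (subst)
    open import Data.Nat.Properties using (≤-trans; ≤-reflexive)
    subst' : ∀ {a b : ℕ} → a ≡ b → 1 ≤ a → 1 ≤ b
    subst' e p = ≤-trans p (≤-reflexive e)
    noLoopAbsurd : ∀ {a : ℕ} → a ≡ 0 → ¬ (1 ≤ a)
    noLoopAbsurd Relation.Binary.PropositionalEquality.refl ()

SimpleForce : ∀ {n} → SimpleGraph n → Subset n → Fin n → Fin n → Set
SimpleForce H B u w =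
  u ∈ B × w ∉ B × Adj u w × (∀ x → Adj u x → x ∉ B → x ≡ w)
  where open SimpleGraph H

MultiForce : ∀ {n} → Multigraph n → Subset n → Fin n → Fin n → Set
MultiForce G B u w =
  u ∈ B × w ∉ B × 1 ≤ mult u w × (∀ x → 1 ≤ mult u x → x ∉ B → x ≡ w)
    × mult u w ≡ 1
  where open Multigraph G

data ForceChain {n : ℕ} (Valid : Subset n → Fin n → Fin n → Set)
     : Subset n → List (Fin n × Fin n) → Set where
  done : ∀ {B} → B ≡ ⊤ → ForceChain Valid B []
  step : ∀ {B u w fs} → Valid B u w → ForceChain Valid (⁅ w ⁆ ∪ B) fs →
         ForceChain Valid B ((u , w) ∷ fs)

IsZFS : ∀ {n} → (Subset n → Fin n → Fin n → Set) → Subset n → Set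
IsZFS Valid S = ∃ λ fs → ForceChain Valid S fs

IsMinZFS : ∀ {n} → (Subset n → Fin n → Fin n → Set) → Subset n → Set
IsMinZFS {n} Valid S = IsZFS Valid S × (∀ (T : Subset n) → IsZFS Valid T → ∣ S ∣ ≤ ∣ T ∣)

ZIs : ∀ {n} → (Subset n → Fin n → Fin n → Set) → ℕ → Set
ZIs {n} Valid k = Σ (Subset n) λ S → IsMinZFS Valid S × ∣ S ∣ ≡ k

ZFS-simple : ∀ {n} → SimpleGraph n → Subset n → Set
ZFS-simple H = IsZFS (SimpleForce H)

ZFS-multi : ∀ {n} → Multigraph n → Subset n → Set
ZFS-multi G = IsZFS (MultiForce G)

MinZFS-simple : ∀ {n} → SimpleGraph n → Subset n → Set
MinZFS-simple H = IsMinZFS (SimpleForce H)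

Z-simple-is : ∀ {n} → SimpleGraph n → ℕ → Set
Z-simple-is H = ZIs (SimpleForce H)

Z-multi-is : ∀ {n} → Multigraph n → ℕ → Set
Z-multi-is G = ZIs (MultiForce G)

-- Every multigraph force is a force in the underlying simple graph, so every zero
-- forcing set of G is one of G' and Z(G') ≤ Z(G). Conversely, a force of G' along a
-- singleton edge is a force of G, so the given chain from S works in G; since S is
-- minimum for G' it is then minimum for G too, and both forcing numbers equal |S|.
module Submission where

open import Defs
open import Data.Nat using (ℕ)
open import Data.Nat.Properties using (≤-antisym)
open import Data.Fin using (Fin)
open import Data.Fin.Subset using (Subset; ∣_∣)
open import Data.List using (List; []; _∷_)
open import Data.List.Relation.Unary.All using (All; []; _∷_)
open import Data.Product using (_×_; _,_; Σ; proj₁; proj₂; map₂)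
open import Relation.Binary.PropositionalEquality using (_≡_; trans)

private
  variable
    n : ℕ
    V W : Subset n → Fin n → Fin n → Set

ForceChain-map : (∀ {B u w} → V B u w → W B u w) →
                 ∀ {B fs} → ForceChain V B fs → ForceChain W B fs
ForceChain-map f (done B≡⊤) = done B≡⊤
ForceChain-map f (step valid rest) = step (f valid) (ForceChain-map f rest)

ForceChain-strengthen : {P : Fin n × Fin n → Set} →
                        (∀ {B u w} → V B u w → P (u , w) → W B u w) →
                        ∀ {B fs} → ForceChain V B fs → All P fs → ForceChain W B fs
ForceChain-strengthen f (done B≡⊤) [] = done B≡⊤
ForceChain-strengthen f (step valid rest) (p ∷ ps) =
  step (f valid p) (ForceChain-strengthen f rest ps)

IsZFS-map : (∀ {B u w} → V B u w → W B u w) → ∀ {S} → IsZFS V S → IsZFS W S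
IsZFS-map f = map₂ (ForceChain-map f)

MultiForce⇒SimpleForce : (G : Multigraph n) →
  ∀ {B u w} → MultiForce G B u w → SimpleForce (underlying G) B u w
MultiForce⇒SimpleForce G (u∈B , w∉B , adj , unique , _) = u∈B , w∉B , adj , unique

SimpleForce⇒MultiForce : (G : Multigraph n) →
  ∀ {B u w} → SimpleForce (underlying G) B u w → Multigraph.mult G u w ≡ 1 →
  MultiForce G B u w
SimpleForce⇒MultiForce G (u∈B , w∉B , adj , unique) single =
  u∈B , w∉B , adj , unique , single

IsMinZFS-strengthen : (∀ {B u w} → W B u w → V B u w) →
                      ∀ {S} → IsMinZFS V S → IsZFS W S → IsMinZFS W S
IsMinZFS-strengthen f (_ , minimal) zfs = zfs , λ T T-zfs → minimal T (IsZFS-map f T-zfs)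

IsMinZFS-∣∣-unique : ∀ {S T} → IsMinZFS V S → IsMinZFS V T → ∣ S ∣ ≡ ∣ T ∣
IsMinZFS-∣∣-unique (S-zfs , S-min) (T-zfs , T-min) = ≤-antisym (S-min _ T-zfs) (T-min _ S-zfs)

ZIs-transfer : ∀ {S k} → IsMinZFS V S → IsMinZFS W S → ZIs V k → ZIs W k
ZIs-transfer S-minV S-minW (T , T-minV , ∣T∣≡k) =
  _ , S-minW , trans (IsMinZFS-∣∣-unique S-minV T-minV) ∣T∣≡k

mainTheorem1 : ∀ {n : ℕ} (G : Multigraph n) (S : Subset n)
    → MinZFS-simple (underlying G) S
    → (Σ (List (Fin n × Fin n)) λ fs →
    ForceChain (SimpleForce (underlying G)) S fs
    × All (λ f → Multigraph.mult G (proj₁ f) (proj₂ f) ≡ 1) fs)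
    → ZFS-multi G S
    × (∀ (k : ℕ) → (Z-simple-is (underlying G) k → Z-multi-is G k)
    × (Z-multi-is G k → Z-simple-is (underlying G) k))
mainTheorem1 G S S-min (fs , chain , singletons) =
  S-zfs , λ k → ZIs-transfer S-min S-minMulti , ZIs-transfer S-minMulti S-min
  where
  S-zfs : ZFS-multi G S
  S-zfs = fs , ForceChain-strengthen (SimpleForce⇒MultiForce G) chain singletons

  S-minMulti : IsMinZFS (MultiForce G) S
  S-minMulti = IsMinZFS-strengthen (MultiForce⇒SimpleForce G) S-min S-zfs
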